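{- For every even integer $k\ge 0$, $M_{k,\mathrm{T}\cdots\mathrm{F}}\le\sqrt{2}^{\,k}$.
   Context: Unordered CNF game: an instance is a pair $(\varphi,X)$ where $\varphi$ is a CNF formula (a set of clauses, each clause a disjunction of literals $x_i$ or $\overline{x}_i$) and $X$ is a finite set of boolean variables containing every variable appearing in $\varphi$. Two players, T and F, alternate turns; on each turn the player picks a not-yet-assigned variable from $X$ and assigns it $0$ or $1$. The game ends when all variables are assigned; T wins if $\varphi$ is satisfied and F wins otherwise. A CNF is $k$-uniform if every clause has exactly $k$ literals, on $k$ distinct variables. $M_{k,\mathrm{T}\cdots\mathrm{F}}$ denotes the minimum number of clauses of $\varphi$ over all instances $(\varphi,X)$ with $\varphi$ $k$-uniform and $|X|$ even such that F has a winning strategy when T moves first (so F moves last). -}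

module Defs where

open import Data.Nat using (ℕ)
open import Data.Bool using (Bool; true; false; not; if_then_else_)
open import Data.Fin using (Fin; _≟_)
open import Data.Vec using (Vec; lookup)
open import Data.List using (List)
open import Data.List.Relation.Unary.All using (All)
open import Data.List.Relation.Unary.Any using (Any)
open import Data.Maybe using (Maybe; just; nothing)
open import Data.Product using (Σ; _×_; _,_; proj₁; proj₂; ∃)
open import Relation.Nullary using (¬_; does)
open import Relation.Binary.PropositionalEquality using (_≡_)

-- Variables of X are Fin n (|X| = n).  A literal is a pair (i , b):
-- (i , true) is x_i and (i , false) is the negation of x_i.
Literal : ℕ → Set
Literal n = Fin n × Bool

record Clause (n k : ℕ) : Set where
  constructor clause
  field
    lits     : Vec (Literal n) k
    distinct : ∀ i j → proj₁ (lookup lits i) ≡ proj₁ (lookup lits j) → i ≡ j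
open Clause public

CNF : ℕ → ℕ → Set
CNF n k = List (Clause n k)

LitSat : ∀ {n} → (Fin n → Bool) → Literal n → Set
LitSat σ (i , b) = σ i ≡ b

ClauseSat : ∀ {n k} → (Fin n → Bool) → Clause n k → Set
ClauseSat σ C = Σ _ λ j → LitSat σ (lookup (lits C) j)

Sat : ∀ {n k} → (Fin n → Bool) → CNF n k → Set
Sat σ φ = All (ClauseSat σ) φ

-- Partial assignments (positions of the game).
PAssign : ℕ → Set
PAssign n = Fin n → Maybe Bool

update : ∀ {n} → PAssign n → Fin n → Bool → PAssign n
update ρ i b j = if does (j ≟ i) then just b else ρ j

data Player : Set where
  T F : Player

-- FWins φ ρ p : from position ρ with player p to move, F has a winning strategy.
data FWins {n k : ℕ} (φ : CNF n k) : PAssign n → Player → Set where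
  end   : ∀ {ρ p} (σ : Fin n → Bool) → (∀ i → ρ i ≡ just (σ i)) → ¬ Sat σ φ →
          FWins φ ρ p
  tmove : ∀ {ρ} → ∃ (λ i → ρ i ≡ nothing) →
          (∀ i b → ρ i ≡ nothing → FWins φ (update ρ i b) F) →
          FWins φ ρ T
  fmove : ∀ {ρ} (i : Fin n) (b : Bool) → ρ i ≡ nothing →
          FWins φ (update ρ i b) T → FWins φ ρ F

FWinsTFirst : ∀ {n k} → CNF n k → Set
FWinsTFirst φ = FWins φ (λ _ → nothing) T

{-# OPTIONS --safe #-}
-- Pair the variables. F answers every move of T by giving the partner of the
-- variable just set the same value; since T moves first and the pairs are disjoint,
-- the partner is still free, and the final assignment is constant on every pair.
-- With k = 2q variables in q pairs, take for each s : Fin q → Bool the clause on all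
-- variables that is falsified exactly when both variables of pair a carry s a.
-- Every pair-constant assignment falsifies one of these 2^q clauses.
module Submission where

open import Defs
open import Data.Nat using (ℕ; _≤_; _^_; _/_)
open import Data.Nat.Divisibility using (_∣_)
open import Data.List using (length)
open import Data.Product using (Σ; _×_)

open import Data.Nat using (_*_)
open import Data.Nat.Divisibility using (divides)
open import Data.Nat.DivMod using (m*n/n≡m)
open import Data.Nat.Properties using (≤-reflexive)
open import Data.Bool using (Bool; true; false; not)
open import Data.Bool.Properties as Bool using (not-¬)
open import Data.Fin using (Fin; zero; suc; _≟_; combine; remQuot; opposite; finToFun; funToFin)
open import Data.Fin.Properties using (any?; combine-remQuot; remQuot-combine; combine-injectiveʳ;
  opposite-involutive; 2↔Bool; finToFun-funToFin)
open import Data.Fin.Subset using (Subset; _∈_; _⊂_)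
open import Data.Fin.Subset.Properties using (⊂-trans)
open import Data.Fin.Subset.Induction using (Acc; acc; ⊂-wellFounded)
open import Data.List using (tabulate)
open import Data.List.Properties using (length-tabulate)
open import Data.List.Relation.Unary.All.Properties using (tabulate⁻)
open import Data.Maybe using (just; nothing; is-nothing; fromMaybe)
open import Data.Maybe.Properties using (≡-dec)
open import Data.Product using (_,_; proj₁; proj₂; ∃)
open import Data.Vec using (lookup) renaming (tabulate to tabulateᵥ)
open import Data.Vec.Properties using (lookup∘tabulate; lookup⇒[]=; []=⇒lookup)
open import Function using (_∘_; Inverse)
open import Relation.Nullary using (¬_; Dec; yes; no; contradiction)
open import Relation.Binary.PropositionalEquality

private
  variable
    n : ℕ

module _ (ρ : PAssign n) (i : Fin n) (b : Bool) where

  update-same : update ρ i b i ≡ just b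
  update-same with i ≟ i
  ... | yes _  = refl
  ... | no i≢i = contradiction refl i≢i

  update-other : ∀ {j} → ¬ j ≡ i → update ρ i b j ≡ ρ j
  update-other {j} j≢i with j ≟ i
  ... | yes j≡i = contradiction j≡i j≢i
  ... | no _    = refl

  update-nothing : ∀ {j} → update ρ i b j ≡ nothing → ρ j ≡ nothing
  update-nothing {j} with j ≟ i
  ... | yes _ = λ ()
  ... | no _  = λ e → e

unassigned : PAssign n → Subset n
unassigned ρ = tabulateᵥ (is-nothing ∘ ρ)

module _ {ρ : PAssign n} {j : Fin n} where

  ∈-unassigned⁺ : ρ j ≡ nothing → j ∈ unassigned ρ
  ∈-unassigned⁺ e = lookup⇒[]= j _ (trans (lookup∘tabulate _ j) (cong is-nothing e))

  ∈-unassigned⁻ : j ∈ unassigned ρ → ρ j ≡ nothing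
  ∈-unassigned⁻ j∈ = is-nothing⇒nothing (ρ j) (trans (sym (lookup∘tabulate _ j)) ([]=⇒lookup j∈))
    where
    is-nothing⇒nothing : ∀ m → is-nothing m ≡ true → m ≡ nothing
    is-nothing⇒nothing nothing _ = refl

update-⊂ : ∀ {ρ : PAssign n} {i b} → ρ i ≡ nothing → unassigned (update ρ i b) ⊂ unassigned ρ
update-⊂ {ρ = ρ} {i} {b} ρi≡nothing =
  (∈-unassigned⁺ ∘ update-nothing ρ i b ∘ ∈-unassigned⁻) ,
  i , ∈-unassigned⁺ ρi≡nothing , λ i∈ → just≢nothing (trans (sym (update-same ρ i b)) (∈-unassigned⁻ i∈))
  where
  just≢nothing : ¬ just b ≡ nothing
  just≢nothing ()

complete : PAssign n → (Fin n → Bool)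
complete ρ = fromMaybe false ∘ ρ

complete-agrees : (ρ : PAssign n) → ¬ ∃ (λ i → ρ i ≡ nothing) → ∀ j → ρ j ≡ just (complete ρ j)
complete-agrees ρ full j with ρ j in e
... | just _  = refl
... | nothing = contradiction (j , e) full

Paired : {A : Set} → (Fin n → Fin n) → (Fin n → A) → Set
Paired p f = ∀ j → f j ≡ f (p j)

module PairingStrategy {k} (φ : CNF n k) (p : Fin n → Fin n)
  (p-involutive : ∀ j → p (p j) ≡ j) (p-fixedPointFree : ∀ j → ¬ p j ≡ j) where

  p-injective : ∀ {i j} → p i ≡ p j → i ≡ j
  p-injective {i} {j} e = trans (sym (p-involutive i)) (trans (cong p e) (p-involutive j))

  module _ (ρ : PAssign n) (i : Fin n) (b : Bool) where

    answer : PAssign n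
    answer = update (update ρ i b) (p i) b

    answer-at : answer i ≡ just b
    answer-at = trans (update-other (update ρ i b) (p i) b (p-fixedPointFree i ∘ sym)) (update-same ρ i b)

    answer-at-partner : answer (p i) ≡ just b
    answer-at-partner = update-same (update ρ i b) (p i) b

    answer-away : ∀ {j} → ¬ j ≡ i → ¬ j ≡ p i → answer j ≡ ρ j
    answer-away j≢i j≢pi = trans (update-other (update ρ i b) (p i) b j≢pi) (update-other ρ i b j≢i)

  answer-paired : ∀ {ρ} i b → Paired p ρ → Paired p (answer ρ i b)
  answer-paired {ρ} i b paired j = by-cases (j ≟ i) (j ≟ p i)
    where
    open ≡-Reasoning
    by-cases : Dec (j ≡ i) → Dec (j ≡ p i) → answer ρ i b j ≡ answer ρ i b (p j)
    by-cases (yes refl) _ = trans (answer-at ρ j b) (sym (answer-at-partner ρ j b))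
    by-cases (no _) (yes refl) = begin
      answer ρ i b (p i)     ≡⟨ answer-at-partner ρ i b ⟩
      just b                 ≡⟨ answer-at ρ i b ⟨
      answer ρ i b i         ≡⟨ cong (answer ρ i b) (p-involutive i) ⟨
      answer ρ i b (p (p i)) ∎
    by-cases (no j≢i) (no j≢pi) = begin
      answer ρ i b j     ≡⟨ answer-away ρ i b j≢i j≢pi ⟩
      ρ j                ≡⟨ paired j ⟩
      ρ (p j)            ≡⟨ answer-away ρ i b (j≢pi ∘ pj≡i⇒j≡pi) (j≢i ∘ p-injective) ⟨
      answer ρ i b (p j) ∎
      where
      pj≡i⇒j≡pi : p j ≡ i → j ≡ p i
      pj≡i⇒j≡pi e = trans (sym (p-involutive j)) (cong p e)

  pairing-strategy-wins : (∀ σ → Paired p σ → ¬ Sat σ φ) → FWinsTFirst φ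
  pairing-strategy-wins paired-falsifies = play _ (⊂-wellFounded _) (λ _ → refl)
    where
    play : ∀ ρ → Acc _⊂_ (unassigned ρ) → Paired p ρ → FWins φ ρ T
    play ρ (acc smaller) paired with any? (λ j → ≡-dec Bool._≟_ (ρ j) nothing)
    ... | no full = end (complete ρ) (complete-agrees ρ full)
                        (paired-falsifies (complete ρ) (cong (fromMaybe false) ∘ paired))
    ... | yes free = tmove free reply
      where
      reply : ∀ i b → ρ i ≡ nothing → FWins φ (update ρ i b) F
      reply i b ρi≡nothing = fmove (p i) b partner-free
        (play (answer ρ i b) (smaller (⊂-trans (update-⊂ partner-free) (update-⊂ ρi≡nothing)))
              (answer-paired i b paired))
        where
        partner-free : update ρ i b (p i) ≡ nothing
        partner-free = trans (update-other ρ i b (p-fixedPointFree i)) (trans (sym (paired i)) ρi≡nothing)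

module PairedVariables (q : ℕ) where

  block : Fin (q * 2) → Fin q
  block = proj₁ ∘ remQuot {q} 2

  side : Fin (q * 2) → Fin 2
  side = proj₂ ∘ remQuot {q} 2

  block-combine : ∀ a e → block (combine a e) ≡ a
  block-combine a e = cong proj₁ (remQuot-combine {q} {2} a e)

  by-combine : {P : Fin (q * 2) → Set} → (∀ a e → P (combine a e)) → ∀ j → P j
  by-combine {P} h j = subst P (combine-remQuot {q} 2 j) (h (block j) (side j))

  partner : Fin (q * 2) → Fin (q * 2)
  partner j = combine (block j) (opposite (side j))

  partner-combine : ∀ a e → partner (combine a e) ≡ combine a (opposite e)
  partner-combine a e =
    cong (λ (r : Fin q × Fin 2) → combine (proj₁ r) (opposite (proj₂ r))) (remQuot-combine {q} {2} a e)

  partner-involutive : ∀ j → partner (partner j) ≡ j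
  partner-involutive = by-combine λ a e → begin
    partner (partner (combine a e))   ≡⟨ cong partner (partner-combine a e) ⟩
    partner (combine a (opposite e))  ≡⟨ partner-combine a (opposite e) ⟩
    combine a (opposite (opposite e)) ≡⟨ cong (combine a) (opposite-involutive e) ⟩
    combine a e                       ∎
    where open ≡-Reasoning

  partner-fixedPointFree : ∀ j → ¬ partner j ≡ j
  partner-fixedPointFree = by-combine λ a e eq →
    opposite-fixedPointFree e (combine-injectiveʳ a (opposite e) a e (trans (sym (partner-combine a e)) eq))
    where
    opposite-fixedPointFree : ∀ (e : Fin 2) → ¬ opposite e ≡ e
    opposite-fixedPointFree zero ()
    opposite-fixedPointFree (suc zero) ()

  paired-constant-on-blocks : ∀ {σ : Fin (q * 2) → Bool} → Paired partner σ →
                              ∀ j → σ j ≡ σ (combine (block j) zero)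
  paired-constant-on-blocks {σ} paired = by-combine λ a e → begin
    σ (combine a e)                       ≡⟨ constant-on-pair a e ⟩
    σ (combine a zero)                    ≡⟨ cong (λ a′ → σ (combine a′ zero)) (block-combine a e) ⟨
    σ (combine (block (combine a e)) zero) ∎
    where
    open ≡-Reasoning
    constant-on-pair : ∀ a e → σ (combine a e) ≡ σ (combine a zero)
    constant-on-pair a zero       = refl
    constant-on-pair a (suc zero) = trans (paired _) (cong σ (partner-combine a (suc zero)))

  blockLiteral : (Fin q → Bool) → Fin (q * 2) → Literal (q * 2)
  blockLiteral s j = j , not (s (block j))

  blockClause : (Fin q → Bool) → Clause (q * 2) (q * 2)
  blockClause s = clause (tabulateᵥ (blockLiteral s)) λ i j e →
    trans (sym (variable-at i)) (trans e (variable-at j))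
    where
    variable-at : ∀ i → proj₁ (lookup (tabulateᵥ (blockLiteral s)) i) ≡ i
    variable-at i = cong proj₁ (lookup∘tabulate (blockLiteral s) i)

  blockClause-falsified : ∀ s {σ} → (∀ j → σ j ≡ s (block j)) → ¬ ClauseSat σ (blockClause s)
  blockClause-falsified s {σ} agree (j , sat) =
    not-¬ (agree j) (subst (LitSat σ) (lookup∘tabulate (blockLiteral s) j) sat)

  signs : Fin (2 ^ q) → Fin q → Bool
  signs i = Inverse.to 2↔Bool ∘ finToFun i

  signs-surjective : ∀ s → ∃ λ i → ∀ a → signs i a ≡ s a
  signs-surjective s = funToFin (from ∘ s) , λ a →
    trans (cong to (finToFun-funToFin (from ∘ s) a)) (strictlyInverseˡ (s a))
    where open Inverse 2↔Bool

  formula : CNF (q * 2) (q * 2)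
  formula = tabulate (blockClause ∘ signs)

  paired-falsifies : ∀ σ → Paired partner σ → ¬ Sat σ formula
  paired-falsifies σ paired sat with signs-surjective (λ a → σ (combine a zero))
  ... | i , signs-i = blockClause-falsified (signs i) agree (tabulate⁻ sat i)
    where
    agree : ∀ j → σ j ≡ signs i (block j)
    agree j = trans (paired-constant-on-blocks paired j) (sym (signs-i (block j)))

lemma5 : (k : ℕ) → 2 ∣ k →
    Σ ℕ λ n → Σ (CNF n k) λ φ →
      2 ∣ n × FWinsTFirst φ × length φ ≤ 2 ^ (k / 2)
lemma5 .(q * 2) (divides q refl) = q * 2 , formula , divides q refl , F-wins , few-clauses
  where
  open PairedVariables q
  F-wins : FWinsTFirst formula
  F-wins = PairingStrategy.pairing-strategy-wins formula partner
             partner-involutive partner-fixedPointFree paired-falsifies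
  few-clauses : length formula ≤ 2 ^ (q * 2 / 2)
  few-clauses = ≤-reflexive (trans (length-tabulate _) (cong (2 ^_) (sym (m*n/n≡m q 2))))
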